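{- In the theory AOT: for every particular object system $o$ and all arbitrary objects $a_\alpha, a_\beta$ occurring in $\mathcal{A}(o)$, we have $ST(a_\alpha) = ST(a_\beta)$.
   Context: AOT is a theory in classical first-order logic with identity, in a language with a binary predicate $\in$, a ternary predicate $Val$ and a binary function symbol $F$ ($F(x,y)$ possibly undefined). Definitions: $P(z)$ ($z$ is a particular object) iff $\exists x\exists y\, Val(x,y,z)$; $A(x)$ ($x$ is an arbitrary object) iff $\exists y\exists z\, Val(x,y,z)$; $S(y)$ ($y$ is a state) iff $\exists x\exists z\, Val(x,y,z)$; $x$ is a set iff $\neg P(x)\wedge\neg A(x)\wedge \neg S(x)$. Particular objects, arbitrary objects and states are Urelements of an auxiliary set theory. Axioms of AOT: (0) the axioms of some Urelement set theory for $\in$ and sets, including Separation for all formulas of the language; (1) there is at least one particular object; (2) the extensions of $P$, $A$, $S$ are pairwise disjoint; (3) $Val$ is a partial function on $A\times S$ (write $Val(a,s)=p$ for $Val(a,s,p)$); (4) for every arbitrary object $a$ the states $s$ with $\exists z\,Val(a,s,z)$ form a set, denoted $ST(a)$ (the state space of $a$). A particular object system is, for some ordinal $\lambda$, a set $o$ of sequences of length $\lambda$ whose entries are particular objects; $l(o)=\lambda$. (5) $F(x,y)$ is defined iff $x$ is a particular object system and $y\in x$, and the range of $F$ is exactly the class of states; write $F_o(x)$ for $F(o,x)$. (6) (Abstraction) for every particular object system $o$ with tuples of length $\lambda$ there is a unique sequence $\mathcal{A}(o)=\langle a_\alpha\rangle$ of arbitrary objects indexed by the positions $\alpha$ of the tuples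 such that: (i) for every $x\in o$ and every position $\alpha$, $Val(a_\alpha, F_o(x)) = x_\alpha$ (the $\alpha$-th entry of $x$); (ii) for every state not in the range of $F_o$, no member of $\mathcal{A}(o)$ takes a value at it; (iii) for every arbitrary object $b$ not among the entries of $\mathcal{A}(o)$ and every $x\in o$, $Val(b,F_o(x))$ is undefined. $\mathcal{A}(o)$ is called an arbitrary object system, and $\mathcal{A}^*(o)$ denotes the set of its entries. (7) every arbitrary object belongs to $\mathcal{A}^*(o)$ for some particular object system $o$. (8) (Internal extensionality) if $a_\alpha,a_\beta\in\mathcal{A}^*(o)$ satisfy $Val(a_\alpha,s)=Val(a_\beta,s)$ for every state $s$ of the form $F_o(x)$ with $x\in o$, then $a_\alpha=a_\beta$. (9) (External extensionality) for arbitrary object systems $A_1,A_2$, if there is a bijection $f$ between the state spaces of $A_1$ and $A_2$ such that for every $a\in A_1$ there is $a'\in A_2$ with $\forall z\,(Val(a,s,z)\leftrightarrow Val(a',f(s),z))$ for all states $s$ of $A_1$, and for every $a\in A_2$ there is $a'\in A_1$ with $\forall z\,(Val(a,s,z)\leftrightarrow Val(a',f^{ -1}(s),z))$ for all states $s$ of $A_2$, then $A_1=A_2$. -}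

module Defs where

open import Data.Product using (Σ; ∃; ∃-syntax; _×_; _,_)
open import Data.Empty using (⊥)
open import Relation.Nullary using (¬_)
open import Relation.Binary.PropositionalEquality using (_≡_)
open import Function.Bundles using (_⇔_)

-- Primitive symbols of AOT: membership, Val (ternary), F (partial
-- binary function, given by its graph FG o x s  :⇔  F(o,x) = s).
--
-- The notions "o is a particular object system", "α is a position of
-- the tuples of o" (α < l(o)), "the α-th entry of the sequence x is p"
-- and "the α-th entry of the sequence 𝒜(o) is a" are set-theoretic /
-- defined notions of AOT; they are taken here as abstract interpreted
-- relations, constrained by the axioms below.

record Sig : Set₁ where
  field
    D        : Set
    _∈_      : D → D → Set
    Val      : D → D → D → Set
    FG       : D → D → D → Set
    IsPOSys  : D → Set
    Position : D → D → Set
    Entry    : D → D → D → Set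
    AOS      : D → D → D → Set

module Notions (σ : Sig) where
  open Sig σ

  P : D → Set
  P z = ∃[ x ] ∃[ y ] Val x y z

  A : D → Set
  A x = ∃[ y ] ∃[ z ] Val x y z

  S : D → Set
  S y = ∃[ x ] ∃[ z ] Val x y z

  IsSet : D → Set
  IsSet x = ¬ P x × ¬ A x × ¬ S x

  Urelement : D → Set
  Urelement x = ¬ IsSet x

  FDef : D → D → Set
  FDef o x = ∃[ s ] FG o x s

  InRangeF : D → D → Set
  InRangeF o s = ∃[ x ] (x ∈ o × FG o x s)

  InSys : D → D → Set
  InSys o a = ∃[ α ] AOS o α a

  IsST : D → D → Set
  IsST a X = IsSet X × (∀ s → (s ∈ X) ⇔ (∃[ z ] Val a s z))

record AOT (σ : Sig) : Set₁ where
  open Sig σ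
  open Notions σ
  field
    classical : {Q : Set} → ¬ ¬ Q → Q
    set-ext     : ∀ X Y → IsSet X → IsSet Y → (∀ z → (z ∈ X) ⇔ (z ∈ Y)) → X ≡ Y
    urelem-empty : ∀ u z → Urelement u → ¬ (z ∈ u)
    ax1 : ∃[ z ] P z
    ax2-PA : ∀ x → P x → ¬ A x
    ax2-PS : ∀ x → P x → ¬ S x
    ax2-AS : ∀ x → A x → ¬ S x
    ax3 : ∀ a s p q → Val a s p → Val a s q → p ≡ q
    ax4 : ∀ a → A a → ∃[ X ] IsST a X
    posys-set   : ∀ o → IsPOSys o → IsSet o
    posys-entry : ∀ o x α → IsPOSys o → x ∈ o → Position o α →
                  ∃[ p ] (Entry x α p × P p)
    ax5-def   : ∀ o x → FDef o x ⇔ (IsPOSys o × x ∈ o)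
    ax5-fun   : ∀ o x s t → FG o x s → FG o x t → s ≡ t
    ax5-range : ∀ s → (∃[ o ] ∃[ x ] FG o x s) ⇔ S s
    ax6-exists : ∀ o α → IsPOSys o → Position o α → ∃[ a ] AOS o α a
    ax6-fun    : ∀ o α a b → AOS o α a → AOS o α b → a ≡ b
    ax6-dom    : ∀ o α a → AOS o α a → IsPOSys o × Position o α × A a
    ax6-i      : ∀ o x α a p s → IsPOSys o → x ∈ o → AOS o α a →
                 FG o x s → Entry x α p → Val a s p
    ax6-ii     : ∀ o α a s z → IsPOSys o → AOS o α a → S s →
                 ¬ InRangeF o s → ¬ Val a s z
    ax6-iii    : ∀ o b x s z → IsPOSys o → A b → ¬ InSys o b →
                 x ∈ o → FG o x s → ¬ Val b s z
    ax7 : ∀ a → A a → ∃[ o ] (IsPOSys o × InSys o a)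
    ax8 : ∀ o α β a b → IsPOSys o → AOS o α a → AOS o β b →
          (∀ x s z → x ∈ o → FG o x s → (Val a s z ⇔ Val b s z)) → a ≡ b

{-# OPTIONS --safe #-}
-- Every member of 𝒜(o) takes a value exactly at the states F_o(x) with x ∈ o:
-- by (6)(i) it takes the α-th entry of x there, and by (6)(ii) it takes no value
-- elsewhere.  So all members of 𝒜(o) have the range of F_o as their state space,
-- and the state spaces, being sets with the same members, coincide.
module Submission where

open import Defs
open import Relation.Binary.PropositionalEquality using (_≡_)
open import Data.Product using (∃-syntax; _,_)
open import Function.Bundles using (_⇔_; mk⇔)
open import Function.Properties.Equivalence using (sym; trans)

module _ (σ : Sig) (ax : AOT σ) where
  open Sig σ
  open Notions σ
  open AOT ax

  valued⇒inRangeF : ∀ {o a s z} → IsPOSys o → InSys o a → Val a s z → InRangeF o s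
  valued⇒inRangeF {o} {a} {s} {z} po (α , aα) v =
    classical λ ¬inRange → ax6-ii o α a s z po aα (a , z , v) ¬inRange v

  inRangeF⇒valued : ∀ {o a s} → IsPOSys o → InSys o a → InRangeF o s → ∃[ p ] Val a s p
  inRangeF⇒valued {o} {a} {s} po (α , aα) (x , x∈o , Fox≡s)
    with _ , positionα , _ ← ax6-dom o α a aα
    with p , xα≡p , _ ← posys-entry o x α po x∈o positionα
    = p , ax6-i o x α a p s po x∈o aα Fox≡s xα≡p

  valued⇔inRangeF : ∀ {o a} → IsPOSys o → InSys o a →
                    ∀ s → (∃[ p ] Val a s p) ⇔ InRangeF o s
  valued⇔inRangeF po a∈𝒜o s =
    mk⇔ (λ (_ , v) → valued⇒inRangeF po a∈𝒜o v) (inRangeF⇒valued po a∈𝒜o)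

  sameStateSpace : ∀ {o a b X Y} → IsPOSys o → InSys o a → InSys o b →
                   IsST a X → IsST b Y → X ≡ Y
  sameStateSpace {X = X} {Y} po a∈𝒜o b∈𝒜o (setX , ∈X) (setY , ∈Y) =
    set-ext X Y setX setY λ s →
      trans (trans (∈X s) (valued⇔inRangeF po a∈𝒜o s))
            (trans (sym (valued⇔inRangeF po b∈𝒜o s)) (sym (∈Y s)))

proposition2 : (σ : Sig) → AOT σ →
    ∀ o a b X Y → Sig.IsPOSys σ o →
    Notions.InSys σ o a → Notions.InSys σ o b →
    Notions.IsST σ a X → Notions.IsST σ b Y → X ≡ Y
proposition2 σ ax o a b X Y = sameStateSpace σ ax
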